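{- Fix $n\ge1$ and let $C_n$ be the total number of procedure calls made during the execution of $\textsc{Generate}()$ (described in the context), counting calls to $\textsc{Generate}$, $\textsc{Dispatch}$, $\textsc{TryClosedWhite}$, $\textsc{TryForward}$, $\textsc{TryClosedBlack}$, $\textsc{TryBackward}$, $\textsc{Recurse}$ and $\textsc{Output}$. Then the total execution time of the algorithm is $O(C_n)$, with an implied constant independent of $n$.
   Context: Cost model: each elementary operation (assignment, comparison, array access, arithmetic on integers, each stack primitive $\textsc{Push}$, $\textsc{Pop}$, $\textsc{StackIsEmpty}$, $\textsc{Mask}$, $\textsc{Reveal}$, and each step of iterating over the stack) takes constant time, and each call of the user-supplied procedure $\textsc{Output}()$ takes constant time. Generating algorithm with parameter $n\ge1$: global counter $c$, arrays $s_0,s_1:\{1..n\}\to\{1..n\}$, stack $S$ (initially empty) with $\textsc{Push}$, $\textsc{Pop}$ (top element), $\textsc{StackIsEmpty}$, and $\textsc{Mask}(t)/\textsc{Reveal}(t)$ (temporarily remove $t$ from $S$ / reinsert it at the same position). $\textsc{Generate}()$: if $n\ge1$: $c\leftarrow2$; $s_0[1]\leftarrow1$; $\textsc{Dispatch}(1)$. Then if $n\ge3$: $c\leftarrow4$; $s_0[1]\leftarrow2$; $s_0[2]\leftarrow3$; $s_0[3]\leftarrow1$; $\textsc{Push}(1)$; $\textsc{Push}(2)$; $\textsc{Dispatch}(3)$. $\textsc{Dispatch}(s)$: $\textsc{TryClosedWhite}(s)$; if $c+3\le n+1$ then $\textsc{TryForward}(s)$; if $c+1\le n+1$ then $\textsc{TryClosedBlack}(s)$;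 for each $t$ currently in $S$: $\textsc{Mask}(t)$; $\textsc{TryBackward}(s,t)$; $\textsc{Reveal}(t)$. $\textsc{TryClosedWhite}(s)$: $s_1[s]\leftarrow s$; $\textsc{Recurse}()$. $\textsc{TryForward}(s)$: $s_0[c]\leftarrow c+1$; $s_0[c+1]\leftarrow c+2$; $s_0[c+2]\leftarrow c$; $s_1[s]\leftarrow c$; $s_1[c]\leftarrow s$; $\textsc{Push}(c+1)$; $\textsc{Push}(c+2)$; $c\leftarrow c+3$; $\textsc{Recurse}()$; $c\leftarrow c-3$; $\textsc{Pop}()$; $\textsc{Pop}()$. $\textsc{TryClosedBlack}(s)$: $s_1[s]\leftarrow c$; $s_1[c]\leftarrow s$; $s_0[c]\leftarrow c$; $c\leftarrow c+1$; $\textsc{Recurse}()$; $c\leftarrow c-1$. $\textsc{TryBackward}(s,t)$: $s_1[s]\leftarrow t$; $s_1[t]\leftarrow s$; $\textsc{Recurse}()$. $\textsc{Recurse}()$: if $S$ empty then $\textsc{Output}()$; else $k\leftarrow\textsc{Pop}()$; $\textsc{Dispatch}(k)$; $\textsc{Push}(k)$. -}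

module Defs where

open import Data.Nat using (ℕ; zero; suc; _+_; _*_; _∸_; _≤_; _≡ᵇ_)
open import Data.Bool using (if_then_else_)
open import Data.List using (List; []; _∷_)
open import Data.Maybe using (Maybe; just; nothing)
open import Relation.Binary.PropositionalEquality using (_≡_)
open import Relation.Nullary using (¬_)

-- Every judgment   P n … st st' T C   means: executing procedure P
-- (for parameter n) from machine state st terminates in state st',
-- spending T elementary time units (cost model of the paper: every
-- elementary operation and every call of Output() costs 1 unit),
-- and making C procedure calls (counting calls to Generate, Dispatch,
-- TryClosedWhite, TryForward, TryClosedBlack, TryBackward, Recurse,
-- Output).  Each judgment counts its own call in C.

-- arrays s₀, s₁ are modelled as functions ℕ → ℕ (only indices 1..n used)
update : (ℕ → ℕ) → ℕ → ℕ → (ℕ → ℕ)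
update f i v j = if i ≡ᵇ j then v else f j

-- the stack: a list with the top element first
pop : List ℕ → List ℕ
pop []       = []
pop (_ ∷ xs) = xs

-- element at position i (0 = top)
at : List ℕ → ℕ → Maybe ℕ
at []       _       = nothing
at (x ∷ xs) zero    = just x
at (x ∷ xs) (suc i) = at xs i

-- Mask: remove the element at position i
removeAt : ℕ → List ℕ → List ℕ
removeAt _       []       = []
removeAt zero    (x ∷ xs) = xs
removeAt (suc i) (x ∷ xs) = x ∷ removeAt i xs

-- Reveal: reinsert t at position i
insertAt : ℕ → ℕ → List ℕ → List ℕ
insertAt zero    t xs       = t ∷ xs
insertAt (suc i) t []       = t ∷ []
insertAt (suc i) t (x ∷ xs) = x ∷ insertAt i t xs

record State : Set where
  constructor mkState
  field
    c   : ℕ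
    s₀  : ℕ → ℕ
    s₁  : ℕ → ℕ
    stk : List ℕ
open State public

setStk : State → List ℕ → State
setStk st xs = record st { stk = xs }

fwdPre : ℕ → State → State
fwdPre s st = mkState (c st + 3)
  (update (update (update (s₀ st) (c st) (c st + 1)) (c st + 1) (c st + 2)) (c st + 2) (c st))
  (update (update (s₁ st) s (c st)) (c st) s)
  (c st + 2 ∷ c st + 1 ∷ stk st)

fwdPost : State → State
fwdPost st = record st { c = c st ∸ 3 ; stk = pop (pop (stk st)) }

cbPre : ℕ → State → State
cbPre s st = record st
  { s₁ = update (update (s₁ st) s (c st)) (c st) s
  ; s₀ = update (s₀ st) (c st) (c st)
  ; c  = c st + 1 }

cbPost : State → State
cbPost st = record st { c = c st ∸ 1 }

cwPre : ℕ → State → State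
cwPre s st = record st { s₁ = update (s₁ st) s s }

backPre : ℕ → ℕ → State → State
backPre s t st = record st { s₁ = update (update (s₁ st) s t) t s }

-- initial arrays (contents irrelevant; never read)
initState : State
initState = mkState 0 (λ _ → 0) (λ _ → 0) []

gen1 : State → State
gen1 st = record st { c = 2 ; s₀ = update (s₀ st) 1 1 }

gen2 : State → State
gen2 st = record st
  { c = 4
  ; s₀ = update (update (update (s₀ st) 1 2) 2 3) 3 1
  ; stk = 2 ∷ 1 ∷ stk st }

mutual
  data Recurse (n : ℕ) : State → State → ℕ → ℕ → Set where
    -- StackIsEmpty test (1) + Output (1); calls: Recurse + Output
    rec-out : ∀ {st} → stk st ≡ [] → Recurse n st st 2 2
    -- StackIsEmpty, Pop, assignment to k, Push: 4 units
    rec-pop : ∀ {st st' k ks T C} → stk st ≡ k ∷ ks →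
      Dispatch n k (setStk st ks) st' T C →
      Recurse n st (setStk st' (k ∷ stk st')) (4 + T) (1 + C)

  data Dispatch (n : ℕ) (s : ℕ) : State → State → ℕ → ℕ → Set where
    disp : ∀ {st st₁ st₂ st₃ st₄ T₁ T₂ T₃ T₄ C₁ C₂ C₃ C₄} →
      TryClosedWhite n s st st₁ T₁ C₁ →
      OptForward n s st₁ st₂ T₂ C₂ →
      OptClosedBlack n s st₂ st₃ T₃ C₃ →
      Loop n s 0 st₃ st₄ T₄ C₄ →
      Dispatch n s st st₄ (T₁ + T₂ + T₃ + T₄) (1 + C₁ + C₂ + C₃ + C₄)

  -- "if c + 3 ≤ n + 1 then TryForward(s)": test costs 4 units
  data OptForward (n : ℕ) (s : ℕ) : State → State → ℕ → ℕ → Set where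
    fwd-yes : ∀ {st st' T C} → c st + 3 ≤ n + 1 →
      TryForward n s st st' T C → OptForward n s st st' (4 + T) C
    fwd-no  : ∀ {st} → ¬ (c st + 3 ≤ n + 1) → OptForward n s st st 4 0

  -- "if c + 1 ≤ n + 1 then TryClosedBlack(s)": test costs 4 units
  data OptClosedBlack (n : ℕ) (s : ℕ) : State → State → ℕ → ℕ → Set where
    cb-yes : ∀ {st st' T C} → c st + 1 ≤ n + 1 →
      TryClosedBlack n s st st' T C → OptClosedBlack n s st st' (4 + T) C
    cb-no  : ∀ {st} → ¬ (c st + 1 ≤ n + 1) → OptClosedBlack n s st st 4 0

  -- "for each t currently in S: Mask(t); TryBackward(s,t); Reveal(t)",
  -- iterating over the positions i = 0,1,… of the stack.  Each iteration
  -- step costs 1 (iteration) + 1 (Mask) + 1 (Reveal); the final exit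
  -- test of the iteration costs 1.
  data Loop (n : ℕ) (s : ℕ) : ℕ → State → State → ℕ → ℕ → Set where
    loop-end  : ∀ {i st} → at (stk st) i ≡ nothing → Loop n s i st st 1 0
    loop-step : ∀ {i t st st₁ st₂ T₁ T₂ C₁ C₂} → at (stk st) i ≡ just t →
      TryBackward n s t (setStk st (removeAt i (stk st))) st₁ T₁ C₁ →
      Loop n s (suc i) (setStk st₁ (insertAt i t (stk st₁))) st₂ T₂ C₂ →
      Loop n s i st st₂ (3 + T₁ + T₂) (C₁ + C₂)

  data TryClosedWhite (n : ℕ) (s : ℕ) : State → State → ℕ → ℕ → Set where
    cw : ∀ {st st' T C} → Recurse n (cwPre s st) st' T C →
      TryClosedWhite n s st st' (2 + T) (1 + C)

  -- 5 array assignments (3 units each: index arithmetic, value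
  -- arithmetic, store), 2 Pushes (2 units each), c ← c+3 (2 units),
  -- then c ← c−3 (2 units), 2 Pops (1 unit each): 25 units
  data TryForward (n : ℕ) (s : ℕ) : State → State → ℕ → ℕ → Set where
    fw : ∀ {st st' T C} → Recurse n (fwdPre s st) st' T C →
      TryForward n s st (fwdPost st') (25 + T) (1 + C)

  -- 3 array assignments (3 units each), c ← c+1 (2), c ← c−1 (2): 13 units
  data TryClosedBlack (n : ℕ) (s : ℕ) : State → State → ℕ → ℕ → Set where
    cb : ∀ {st st' T C} → Recurse n (cbPre s st) st' T C →
      TryClosedBlack n s st (cbPost st') (13 + T) (1 + C)

  -- s₁[s] ← t; s₁[t] ← s: 6 units
  data TryBackward (n : ℕ) (s : ℕ) (t : ℕ) : State → State → ℕ → ℕ → Set where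
    bw : ∀ {st st' T C} → Recurse n (backPre s t st) st' T C →
      TryBackward n s t st st' (6 + T) (1 + C)

-- Generate(): test n ≥ 1 (1 unit), c ← 2; s₀[1] ← 1 (3 units),
-- Dispatch(1); test n ≥ 3 (1 unit); c ← 4, three assignments,
-- two Pushes (1 + 6 + 2 = 9 units); Dispatch(3).
data Generate (n : ℕ) : ℕ → ℕ → Set where
  gen-none  : ¬ (1 ≤ n) → Generate n 1 1
  gen-small : ∀ {st T C} → 1 ≤ n → ¬ (3 ≤ n) →
    Dispatch n 1 (gen1 initState) st T C →
    Generate n (5 + T) (1 + C)
  gen-big   : ∀ {st st' T T' C C'} → 1 ≤ n → 3 ≤ n →
    Dispatch n 1 (gen1 initState) st T C →
    Dispatch n 3 (gen2 st) st' T' C' →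
    Generate n (14 + T + T') (1 + C + C')

-- The running time is charged to the procedure calls: apart from the work
-- done inside the procedures it calls, every procedure performs at most 30
-- elementary operations, once the loop overhead of each iteration of
-- Dispatch's backward loop is charged to the TryBackward call it makes.  That Generate() terminates
-- at all follows from the potential |S| + 3(n + 1 − c): it never grows
-- across a call, and every Pop in Recurse strictly decreases it.
module Submission where

open import Defs
open import Data.Nat using (ℕ; zero; suc; _+_; _*_; _∸_; _≤_; z≤n; s≤s; s≤s⁻¹; _≤?_)
open import Data.Nat.Properties
open import Data.Nat.Tactic.RingSolver using (solve-∀)
open import Data.List using (List; []; _∷_; length)
open import Data.Maybe using (just; nothing)
open import Data.Product using (_×_; _,_; ∃-syntax)
open import Data.Empty using (⊥-elim)
open import Relation.Nullary using (¬_; yes; no)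
open import Relation.Nullary.Decidable using (True; toWitness)
open import Relation.Binary.PropositionalEquality

-- opaque, so that a bound  T ≤ costPerCall * C  keeps its shape instead of unfolding
opaque
  costPerCall : ℕ
  costPerCall = 30

  overhead≤costPerCall : ∀ a {a≤30 : True (a ≤? 30)} → a ≤ costPerCall
  overhead≤costPerCall a {a≤30} = toWitness a≤30

add-bounds : ∀ {k a₁ a₂ T₁ T₂ C₁ C₂} →
  T₁ ≤ a₁ + k * C₁ → T₂ ≤ a₂ + k * C₂ → T₁ + T₂ ≤ (a₁ + a₂) + k * (C₁ + C₂)
add-bounds {k} {a₁} {a₂} {C₁ = C₁} {C₂} h₁ h₂ =
  ≤-trans (+-mono-≤ h₁ h₂) (≤-reflexive (regroup k a₁ a₂ C₁ C₂))
  where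
  regroup : ∀ k a₁ a₂ C₁ C₂ →
    (a₁ + k * C₁) + (a₂ + k * C₂) ≡ (a₁ + a₂) + k * (C₁ + C₂)
  regroup = solve-∀

absorb-overhead : ∀ {k a T C} → a ≤ k → T ≤ a + k * C → T ≤ k * suc C
absorb-overhead {k} {C = C} a≤k h =
  ≤-trans h (≤-trans (+-monoˡ-≤ (k * C) a≤k) (≤-reflexive (sym (*-suc k C))))

mutual
  recurse-cost : ∀ {n st st' T C} → Recurse n st st' T C → T ≤ costPerCall * C
  recurse-cost (rec-out _)   = absorb-overhead (overhead≤costPerCall 2) (m≤m+n 2 _)
  recurse-cost (rec-pop _ d) = absorb-overhead (overhead≤costPerCall 4) (+-monoʳ-≤ 4 (dispatch-cost d))

  dispatch-cost : ∀ {n s st st' T C} → Dispatch n s st st' T C → T ≤ costPerCall * C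
  dispatch-cost (disp w f b l) =
    absorb-overhead (overhead≤costPerCall 9)
      (add-bounds {costPerCall}
        (add-bounds {costPerCall}
          (add-bounds {costPerCall} {a₁ = 0} (closedWhite-cost w) (optForward-cost f))
          (optClosedBlack-cost b))
        (loop-cost l))

  optForward-cost : ∀ {n s st st' T C} → OptForward n s st st' T C → T ≤ 4 + costPerCall * C
  optForward-cost (fwd-yes _ f) = +-monoʳ-≤ 4 (forward-cost f)
  optForward-cost (fwd-no _)    = m≤m+n 4 _

  optClosedBlack-cost : ∀ {n s st st' T C} → OptClosedBlack n s st st' T C → T ≤ 4 + costPerCall * C
  optClosedBlack-cost (cb-yes _ b) = +-monoʳ-≤ 4 (closedBlack-cost b)
  optClosedBlack-cost (cb-no _)    = m≤m+n 4 _

  loop-cost : ∀ {n s i st st' T C} → Loop n s i st st' T C → T ≤ 1 + costPerCall * C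
  loop-cost (loop-end _)      = m≤m+n 1 _
  loop-cost (loop-step _ b l) = add-bounds {costPerCall} {a₁ = 0} (backwardIteration-cost b) (loop-cost l)

  closedWhite-cost : ∀ {n s st st' T C} → TryClosedWhite n s st st' T C → T ≤ costPerCall * C
  closedWhite-cost (cw r) = absorb-overhead (overhead≤costPerCall 2) (+-monoʳ-≤ 2 (recurse-cost r))

  forward-cost : ∀ {n s st st' T C} → TryForward n s st st' T C → T ≤ costPerCall * C
  forward-cost (fw r) = absorb-overhead (overhead≤costPerCall 25) (+-monoʳ-≤ 25 (recurse-cost r))

  closedBlack-cost : ∀ {n s st st' T C} → TryClosedBlack n s st st' T C → T ≤ costPerCall * C
  closedBlack-cost (cb r) = absorb-overhead (overhead≤costPerCall 13) (+-monoʳ-≤ 13 (recurse-cost r))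

  -- includes the 3 units of the loop iteration that makes the call
  backwardIteration-cost : ∀ {n s t st st' T C} → TryBackward n s t st st' T C →
    3 + T ≤ costPerCall * C
  backwardIteration-cost (bw r) = absorb-overhead (overhead≤costPerCall 9) (+-monoʳ-≤ 9 (recurse-cost r))

generate-cost : ∀ {n T C} → Generate n T C → T ≤ costPerCall * C
generate-cost (gen-none _)         = absorb-overhead (overhead≤costPerCall 1) (m≤m+n 1 _)
generate-cost (gen-small _ _ d)    = absorb-overhead (overhead≤costPerCall 5) (+-monoʳ-≤ 5 (dispatch-cost d))
generate-cost (gen-big _ _ d₁ d₂) =
  absorb-overhead (overhead≤costPerCall 14)
    (add-bounds {costPerCall} {a₂ = 0} (+-monoʳ-≤ 14 (dispatch-cost d₁)) (dispatch-cost d₂))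

insertAt-removeAt : ∀ i {t} {xs ys : List ℕ} → at xs i ≡ just t → ys ≡ removeAt i xs → insertAt i t ys ≡ xs
insertAt-removeAt zero    {xs = x ∷ xs} refl refl = refl
insertAt-removeAt (suc i) {xs = x ∷ xs} eq   refl = cong (x ∷_) (insertAt-removeAt i eq refl)

length-removeAt : ∀ i (xs : List ℕ) → length (removeAt i xs) ≤ length xs
length-removeAt i       []       = z≤n
length-removeAt zero    (x ∷ xs) = n≤1+n _
length-removeAt (suc i) (x ∷ xs) = s≤s (length-removeAt i xs)

at-beyond-length : ∀ i (xs : List ℕ) → length xs ≤ i → at xs i ≡ nothing
at-beyond-length i       []       _   = refl
at-beyond-length (suc i) (x ∷ xs) h   = at-beyond-length i xs (s≤s⁻¹ h)

record Restores (st st' : State) : Set where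
  constructor restores
  field
    counter : c st' ≡ c st
    stack   : stk st' ≡ stk st

restores-trans : ∀ {st₁ st₂ st₃} → Restores st₁ st₂ → Restores st₂ st₃ → Restores st₁ st₃
restores-trans (restores c₁₂ s₁₂) (restores c₂₃ s₂₃) = restores (trans c₂₃ c₁₂) (trans s₂₃ s₁₂)

data Terminates (J : State → State → ℕ → ℕ → Set) (st : State) : Set where
  terminates : ∀ {st' T C} → J st st' T C → Restores st st' → Terminates J st

-- The fuel f bounds the potential |S| + 3 (n + 1 − c).
record Budget (n f : ℕ) (st : State) : Set where
  field
    counter≤   : c st ≤ n + 1
    potential≤ : length (stk st) + 3 * (n + 1) ≤ f + 3 * c st
open Budget

budget-restored : ∀ {n f st st'} → Restores st st' → Budget n f st → Budget n f st'
budget-restored (restores refl refl) b = record { counter≤ = counter≤ b ; potential≤ = potential≤ b }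

budget-exhausted : ∀ {n st k ks} → stk st ≡ k ∷ ks → ¬ Budget n 0 st
budget-exhausted {n} {st} {ks = ks} eq b = <⇒≱ (≤-trans (s≤s (m≤n+m _ (length ks))) potential) (*-monoʳ-≤ 3 (counter≤ b))
  where
  potential : suc (length ks) + 3 * (n + 1) ≤ 3 * c st
  potential = subst (λ xs → length xs + 3 * (n + 1) ≤ 3 * c st) eq (potential≤ b)

budget-pop : ∀ {n f st k ks} → stk st ≡ k ∷ ks → Budget n (suc f) st → Budget n f (setStk st ks)
budget-pop {n} {f} {st} eq b = record
  { counter≤   = counter≤ b
  ; potential≤ = s≤s⁻¹ (subst (λ xs → length xs + 3 * (n + 1) ≤ suc f + 3 * c st) eq (potential≤ b))
  }

budget-forward : ∀ {n f st} s → c st + 3 ≤ n + 1 → Budget n f st → Budget n f (fwdPre s st)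
budget-forward {n} {f} {st} s c+3≤ b = record
  { counter≤   = c+3≤
  ; potential≤ = ≤-trans (+-monoʳ-≤ 2 (potential≤ b))
                  (≤-trans (+-monoˡ-≤ _ (m≤m+n 2 7)) (≤-reflexive (shift f (c st))))
  }
  where
  shift : ∀ f c → 9 + (f + 3 * c) ≡ f + 3 * (c + 3)
  shift = solve-∀

budget-closedBlack : ∀ {n f st} s → c st + 1 ≤ n + 1 → Budget n f st → Budget n f (cbPre s st)
budget-closedBlack {f = f} {st} s c+1≤ b = record
  { counter≤   = c+1≤
  ; potential≤ = ≤-trans (potential≤ b) (+-monoʳ-≤ f (*-monoʳ-≤ 3 (m≤m+n (c st) 1)))
  }

budget-backward : ∀ {n f st} s t i → Budget n f st → Budget n f (backPre s t (setStk st (removeAt i (stk st))))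
budget-backward {st = st} s t i b = record
  { counter≤   = counter≤ b
  ; potential≤ = ≤-trans (+-monoˡ-≤ _ (length-removeAt i (stk st))) (potential≤ b)
  }

module _ (n : ℕ) where
  mutual
    recurse-terminates : ∀ f st → Budget n f st → Terminates (Recurse n) st
    recurse-terminates f st b with stk st in eq
    ... | [] = terminates (rec-out eq) (restores refl refl)
    recurse-terminates zero    st b | k ∷ ks = ⊥-elim (budget-exhausted eq b)
    recurse-terminates (suc f) st b | k ∷ ks
      with dispatch-terminates f k (setStk st ks) (budget-pop eq b)
    ... | terminates d (restores c≡ stk≡) =
      terminates (rec-pop eq d) (restores c≡ (trans (cong (k ∷_) stk≡) (sym eq)))

    dispatch-terminates : ∀ f s st → Budget n f st → Terminates (Dispatch n s) st
    dispatch-terminates f s st b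
      with closedWhite-terminates f s st b
    ... | terminates {st₁} w ρ₁
      with optForward-terminates f s st₁ (budget-restored ρ₁ b)
    ... | terminates {st₂} o₂ ρ₂
      with optClosedBlack-terminates f s st₂ (budget-restored (restores-trans ρ₁ ρ₂) b)
    ... | terminates {st₃} o₃ ρ₃
      with loop-terminates f s 0 _ st₃ (budget-restored (restores-trans (restores-trans ρ₁ ρ₂) ρ₃) b) refl
    ... | terminates o₄ ρ₄ =
      terminates (disp w o₂ o₃ o₄) (restores-trans (restores-trans (restores-trans ρ₁ ρ₂) ρ₃) ρ₄)

    closedWhite-terminates : ∀ f s st → Budget n f st → Terminates (TryClosedWhite n s) st
    closedWhite-terminates f s st b
      with recurse-terminates f (cwPre s st) (budget-restored (restores refl refl) b)
    ... | terminates r (restores c≡ stk≡) = terminates (cw r) (restores c≡ stk≡)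

    optForward-terminates : ∀ f s st → Budget n f st → Terminates (OptForward n s) st
    optForward-terminates f s st b with c st + 3 ≤? n + 1
    ... | no ¬room = terminates (fwd-no ¬room) (restores refl refl)
    ... | yes room with recurse-terminates f (fwdPre s st) (budget-forward s room b)
    ... | terminates r (restores c≡ stk≡) =
      terminates (fwd-yes room (fw r))
        (restores (trans (cong (_∸ 3) c≡) (m+n∸n≡m (c st) 3)) (cong (λ xs → pop (pop xs)) stk≡))

    optClosedBlack-terminates : ∀ f s st → Budget n f st → Terminates (OptClosedBlack n s) st
    optClosedBlack-terminates f s st b with c st + 1 ≤? n + 1
    ... | no ¬room = terminates (cb-no ¬room) (restores refl refl)
    ... | yes room with recurse-terminates f (cbPre s st) (budget-closedBlack s room b)
    ... | terminates r (restores c≡ stk≡) =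
      terminates (cb-yes room (cb r)) (restores (trans (cong (_∸ 1) c≡) (m+n∸n≡m (c st) 1)) stk≡)

    -- the loop is at position i of the stack, with r positions left
    loop-terminates : ∀ f s i r st → Budget n f st → length (stk st) ≡ i + r → Terminates (Loop n s i) st
    loop-terminates f s i zero st b len≡ =
      terminates (loop-end (at-beyond-length i (stk st) (≤-reflexive (trans len≡ (+-identityʳ i))))) (restores refl refl)
    loop-terminates f s i (suc r) st b len≡ with at (stk st) i in eq
    ... | nothing = terminates (loop-end eq) (restores refl refl)
    ... | just t
      with recurse-terminates f (backPre s t (setStk st (removeAt i (stk st)))) (budget-backward s t i b)
    ... | terminates {st₁} r₁ (restores c≡ stk≡)
      with loop-terminates f s (suc i) r (setStk st₁ (insertAt i t (stk st₁)))
             (budget-restored (restores c≡ revealed) b) (trans (cong length revealed) (trans len≡ (+-suc i r)))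
      where
      revealed : insertAt i t (stk st₁) ≡ stk st
      revealed = insertAt-removeAt i eq stk≡
    ... | terminates l ρ =
      terminates (loop-step eq (bw r₁) l) (restores-trans (restores c≡ (insertAt-removeAt i eq stk≡)) ρ)

budget-initial : ∀ {n st} → c st ≤ n + 1 → length (stk st) ≤ 3 * c st → Budget n (3 * (n + 1)) st
budget-initial {n} {st} c≤ len≤ = record
  { counter≤   = c≤
  ; potential≤ = ≤-trans (≤-reflexive (+-comm (length (stk st)) _)) (+-monoʳ-≤ (3 * (n + 1)) len≤)
  }

generate-terminates : ∀ n → 1 ≤ n → ∃[ T ] ∃[ C ] Generate n T C
generate-terminates n 1≤n
  with dispatch-terminates n _ 1 (gen1 initState) (budget-initial (+-monoˡ-≤ 1 1≤n) z≤n)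
... | terminates {st} d₁ ρ with 3 ≤? n
... | no  3≰n = _ , _ , gen-small 1≤n 3≰n d₁
... | yes 3≤n with dispatch-terminates n _ 3 (gen2 st) (budget-initial (+-monoˡ-≤ 1 3≤n) stack≤)
  where
  stack≤ : length (stk (gen2 st)) ≤ 3 * 4
  stack≤ = ≤-trans (≤-reflexive (cong (λ xs → 2 + length xs) (Restores.stack ρ))) (m≤m+n 2 10)
... | terminates d₂ _ = _ , _ , gen-big 1≤n 3≤n d₁ d₂

lemma3p4 : ∃[ K ] ((n : ℕ) → 1 ≤ n →
    ((T C : ℕ) → Generate n T C → T ≤ K * C)
    × (∃[ T ] ∃[ C ] Generate n T C))
lemma3p4 = costPerCall , λ n 1≤n → (λ _ _ → generate-cost) , generate-terminates n 1≤n
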